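{- Let $k\ge 2$ be an integer, let $n$ be a $k$-full positive integer and let $t$ be any $k$-full positive divisor of $n$. Then $$\mathrm{Rad}\Bigl(\frac{n}{t}\Bigr)\le \frac{n^{1/k}}{t^{1/k^2}}.$$
   Context: For an integer $k\ge 2$, a positive integer $n$ is called $k$-full (or $k$-powerful) if every prime $p$ dividing $n$ satisfies $p^k\mid n$; in particular $1$ is $k$-full. $\mathrm{Rad}(n)$ denotes the product of the distinct primes dividing $n$, with $\mathrm{Rad}(1)=1$. -}

module Defs where

open import Data.Nat using (ℕ; suc; _*_; _^_)
open import Data.Nat.Divisibility using (_∣_; _∣?_)
open import Data.Nat.Primality using (Prime; prime?)
open import Data.List using (List; map; upTo)
open import Data.Nat.ListAction using (product)
open import Data.Bool using (if_then_else_)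
open import Relation.Nullary using (does)
open import Relation.Nullary.Decidable using (_×-dec_)

KFull : ℕ → ℕ → Set
KFull k n = ∀ p → Prime p → p ∣ n → p ^ k ∣ n

-- Rad n: product of the distinct primes dividing n (Rad 1 = 1).
-- For n ≥ 1 every prime divisor of n is ≤ n, so ranging over p < n + 1 suffices.
Rad : ℕ → ℕ
Rad n = product (map (λ p → if does (prime? p ×-dec p ∣? n) then p else 1) (upTo (suc n)))

-- For every prime p ∣ m, where n = m t: if p ∤ t then p^k ∣ m (p^k ∣ n and p is coprime to t),
-- so p^(k²) ∣ m^k; if p ∣ t then p^k ∣ t, so p^(k²) = p^k · (p^k)^(k-1) ∣ m^k t^(k-1).
-- Distinct primes are coprime, hence Rad(m)^(k²) ∣ m^k t^(k-1), and multiplying by t gives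
-- Rad(m)^(k²) · t ∣ n^k, which is the k²-th power of the claimed inequality.
module Submission where

open import Defs
open import Data.Nat using (ℕ; zero; suc; _+_; _*_; _^_; _≤_; _<_; s≤s; >-nonZero)
open import Data.Nat.Properties
  using (*-comm; *-assoc; *-suc; *-identityˡ; ^-zeroˡ; ^-*-assoc; ^-distribˡ-+-*; m^n≢0)
open import Data.Nat.Divisibility
open import Data.Nat.Primality using (Prime; prime?; euclidsLemma; prime⇒irreducible; prime⇒nonZero; ¬prime[1])
open import Data.Nat.ListAction using (product)
open import Data.List using ([]; _∷_; map; upTo)
open import Data.List.Relation.Unary.All using (All; _∷_)
open import Data.List.Relation.Unary.AllPairs using ([]; _∷_)
open import Data.List.Relation.Unary.Unique.Propositional using (Unique)
open import Data.List.Relation.Unary.Unique.Propositional.Properties using (upTo⁺)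
open import Data.Bool using (if_then_else_)
open import Data.Sum using (inj₁; inj₂)
open import Data.Empty using (⊥-elim)
open import Relation.Nullary using (¬_; yes; no; does)
open import Relation.Nullary.Decidable using (_×-dec_)
open import Relation.Binary.PropositionalEquality
  using (_≡_; _≢_; refl; sym; trans; cong; subst; subst₂; module ≡-Reasoning)

^-distribʳ-* : ∀ a b k → (a * b) ^ k ≡ a ^ k * b ^ k
^-distribʳ-* a b zero    = refl
^-distribʳ-* a b (suc k) = begin
  a * b * (a * b) ^ k        ≡⟨ cong (a * b *_) (^-distribʳ-* a b k) ⟩
  a * b * (a ^ k * b ^ k)    ≡⟨ *-assoc a b _ ⟩
  a * (b * (a ^ k * b ^ k))  ≡⟨ cong (a *_) (swap-middle b (a ^ k) (b ^ k)) ⟩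
  a * (a ^ k * (b * b ^ k))  ≡⟨ sym (*-assoc a (a ^ k) _) ⟩
  a * a ^ k * (b * b ^ k)    ∎
  where
  open ≡-Reasoning
  swap-middle : ∀ x y z → x * (y * z) ≡ y * (x * z)
  swap-middle x y z = trans (sym (*-assoc x y z))
                        (trans (cong (_* z) (*-comm x y)) (*-assoc y x z))

^-mono-∣ : ∀ {a b} k → a ∣ b → a ^ k ∣ b ^ k
^-mono-∣ zero    a∣b = ∣-refl
^-mono-∣ (suc k) a∣b = *-pres-∣ a∣b (^-mono-∣ k a∣b)

prime⇒∤1 : ∀ {p} → Prime p → ¬ p ∣ 1
prime⇒∤1 pp p∣1 with ∣1⇒≡1 p∣1
... | refl = ¬prime[1] pp

prime∤⇒∤^ : ∀ {p a} k → Prime p → ¬ p ∣ a → ¬ p ∣ a ^ k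
prime∤⇒∤^ zero    pp p∤a = prime⇒∤1 pp
prime∤⇒∤^ {a = a} (suc k) pp p∤a p∣a^k+1 with euclidsLemma a (a ^ k) pp p∣a^k+1
... | inj₁ p∣a   = p∤a p∣a
... | inj₂ p∣a^k = prime∤⇒∤^ k pp p∤a p∣a^k

prime^-∣-cancelˡ : ∀ {p t} k m → Prime p → ¬ p ∣ t → p ^ k ∣ t * m → p ^ k ∣ m
prime^-∣-cancelˡ zero m pp p∤t _ = 1∣ m
prime^-∣-cancelˡ {p} {t} (suc k) m pp p∤t p^k+1∣tm
  with euclidsLemma t m pp (∣-trans (m∣m*n (p ^ k)) p^k+1∣tm)
... | inj₁ p∣t = ⊥-elim (p∤t p∣t)
... | inj₂ (divides q refl) = subst (p ^ suc k ∣_) (*-comm p q) (*-monoʳ-∣ p p^k∣q)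
  where
  instance _ = prime⇒nonZero pp
  tqp≡p[tq] : t * (q * p) ≡ p * (t * q)
  tqp≡p[tq] = trans (sym (*-assoc t q p)) (*-comm (t * q) p)
  p^k∣q : p ^ k ∣ q
  p^k∣q = prime^-∣-cancelˡ k q pp p∤t
            (*-cancelˡ-∣ p (subst (p ^ suc k ∣_) tqp≡p[tq] p^k+1∣tm))

radFactor : ℕ → ℕ → ℕ
radFactor m p = if does (prime? p ×-dec p ∣? m) then p else 1

module _ (m : ℕ) where

  prime∉⇒∤-product-radFactor : ∀ {p} xs → Prime p → All (p ≢_) xs →
                               ¬ p ∣ product (map (radFactor m) xs)
  prime∉⇒∤-product-radFactor []       pp _ = prime⇒∤1 pp
  prime∉⇒∤-product-radFactor (x ∷ xs) pp (p≢x ∷ p∉xs) p∣prod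
    with prime? x | x ∣? m
  ... | no _  | _     = prime∉⇒∤-product-radFactor xs pp p∉xs (subst (_ ∣_) (*-identityˡ (product (map (radFactor m) xs))) p∣prod)
  ... | yes _ | no _  = prime∉⇒∤-product-radFactor xs pp p∉xs (subst (_ ∣_) (*-identityˡ (product (map (radFactor m) xs))) p∣prod)
  ... | yes px | yes _ with euclidsLemma x _ pp p∣prod
  ...   | inj₂ p∣rest = prime∉⇒∤-product-radFactor xs pp p∉xs p∣rest
  ...   | inj₁ p∣x with prime⇒irreducible px p∣x
  ...     | inj₁ refl = prime⇒∤1 pp ∣-refl
  ...     | inj₂ p≡x  = p≢x p≡x

  product-radFactor^-∣ : ∀ K {X} → (∀ p → Prime p → p ∣ m → p ^ K ∣ X) →
                         ∀ xs → Unique xs → product (map (radFactor m) xs) ^ K ∣ X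
  product-radFactor^-∣ K {X} _ [] _ = subst (_∣ X) (sym (^-zeroˡ K)) (1∣ X)
  product-radFactor^-∣ K {X} H (x ∷ xs) (x∉xs ∷ u) with prime? x | x ∣? m
  ... | no _  | _    = subst (_∣ X) (cong (_^ K) (sym (*-identityˡ (product (map (radFactor m) xs))))) (product-radFactor^-∣ K H xs u)
  ... | yes _ | no _ = subst (_∣ X) (cong (_^ K) (sym (*-identityˡ (product (map (radFactor m) xs))))) (product-radFactor^-∣ K H xs u)
  ... | yes px | yes x∣m =
    subst₂ _∣_ (trans (*-comm (P ^ K) (x ^ K)) (sym (^-distribʳ-* x P K))) (sym X≡P^K*y)
      (*-monoʳ-∣ (P ^ K) x^K∣y)
    where
    P = product (map (radFactor m) xs)
    P^K∣X : P ^ K ∣ X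
    P^K∣X = product-radFactor^-∣ K H xs u
    y = quotient P^K∣X
    X≡P^K*y : X ≡ P ^ K * y
    X≡P^K*y = m∣n⇒n≡m*quotient P^K∣X
    x^K∣y : x ^ K ∣ y
    x^K∣y = prime^-∣-cancelˡ K y px
              (prime∤⇒∤^ K px (prime∉⇒∤-product-radFactor xs px x∉xs))
              (subst (x ^ K ∣_) X≡P^K*y (H x px x∣m))

  Rad^-∣ : ∀ K {X} → (∀ p → Prime p → p ∣ m → p ^ K ∣ X) → Rad m ^ K ∣ X
  Rad^-∣ K H = product-radFactor^-∣ K H (upTo (suc m)) (upTo⁺ (suc m))

-- Stated for k = suc j, so that t ^ j is t^(k-1) without truncated subtraction.
prime∣m⇒prime^k²-∣ : ∀ j {m t p} → KFull (suc j) (m * t) → KFull (suc j) t →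
                     Prime p → p ∣ m → p ^ (suc j * suc j) ∣ m ^ suc j * t ^ j
prime∣m⇒prime^k²-∣ j {m} {t} {p} full-mt full-t pp p∣m with p ∣? t
... | no p∤t = subst (_∣ m ^ k * t ^ j) (^-*-assoc p k k)
                 (∣-trans (^-mono-∣ k p^k∣m) (m∣m*n (t ^ j)))
  where
  k = suc j
  p^k∣m : p ^ k ∣ m
  p^k∣m = prime^-∣-cancelˡ k m pp p∤t
            (subst (p ^ k ∣_) (*-comm m t) (full-mt p pp (∣-trans p∣m (m∣m*n t))))
... | yes p∣t = subst (_∣ m ^ k * t ^ j) p^k*[p^k]^j≡p^kk
                  (*-pres-∣ (^-mono-∣ k p∣m) (^-mono-∣ j (full-t p pp p∣t)))
  where
  k = suc j
  open ≡-Reasoning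
  p^k*[p^k]^j≡p^kk : p ^ k * (p ^ k) ^ j ≡ p ^ (k * k)
  p^k*[p^k]^j≡p^kk = begin
    p ^ k * (p ^ k) ^ j  ≡⟨ cong (p ^ k *_) (^-*-assoc p k j) ⟩
    p ^ k * p ^ (k * j)  ≡⟨ sym (^-distribˡ-+-* p k (k * j)) ⟩
    p ^ (k + k * j)      ≡⟨ cong (p ^_) (sym (*-suc k j)) ⟩
    p ^ (k * k)          ∎

Rad^k²*t∣n^k : ∀ j {m t} → KFull (suc j) (m * t) → KFull (suc j) t →
               Rad m ^ (suc j * suc j) * t ∣ (m * t) ^ suc j
Rad^k²*t∣n^k j {m} {t} full-mt full-t =
  subst (Rad m ^ (k * k) * t ∣_) m^k*t^j*t≡[mt]^k
    (*-monoˡ-∣ t (Rad^-∣ m (k * k) (λ p → prime∣m⇒prime^k²-∣ j full-mt full-t)))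
  where
  k = suc j
  open ≡-Reasoning
  m^k*t^j*t≡[mt]^k : m ^ k * t ^ j * t ≡ (m * t) ^ k
  m^k*t^j*t≡[mt]^k = begin
    m ^ k * t ^ j * t    ≡⟨ *-assoc (m ^ k) (t ^ j) t ⟩
    m ^ k * (t ^ j * t)  ≡⟨ cong (m ^ k *_) (*-comm (t ^ j) t) ⟩
    m ^ k * t ^ k        ≡⟨ sym (^-distribʳ-* m t k) ⟩
    (m * t) ^ k          ∎

lemma1 : (k n t : ℕ) → 2 ≤ k → 0 < n → KFull k n → 0 < t → KFull k t → t ∣ n →
    (m : ℕ) → n ≡ m * t → Rad m ^ (k * k) * t ≤ n ^ k
lemma1 (suc j) n t (s≤s _) n>0 full-n _ full-t _ m refl =
  ∣⇒≤ {{m^n≢0 n (suc j) {{>-nonZero n>0}}}} (Rad^k²*t∣n^k j {m} full-n full-t)
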